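{- Let $G$ be a locally finite connected graph. If $G$ has the finite-step retaining property of degree $d$, then either $G$ has the containment property of degree $d$, or $G$ has at least two ends.
   Context: $G$ carries the path-metric on its vertex set and the weak topology (for ends). Growth: for non-decreasing $f,g\colon\mathbb N\to\mathbb N$, $f\preceq g$ means there is an integer $C>0$ with $f(n)\le Cg(Cn+C)+C$ for all $n$; $f\sim g$ means both; for a vertex set $Y$ with the restricted path-metric and nonempty finite $A\subseteq Y$, $\beta_{Y,A}(n)=|\{y\in Y:\mathrm{dist}(A,y)\le n\}|$, and $\mathsf{Growth}(Y)$ is its $\sim$-class. Fire game (reach $1$): for positive integers $\{f_n\}$, an $\{f_n\}$-strategy is a sequence $\{W_n\}_{n\ge1}$ of vertex sets with $|W_n|\le f_n$; for a finite initial fire $X_0$, for $n>0$, $X_n$ consists of vertices connected to a vertex of $X_{n-1}$ by a path of length at most $1$ containing no vertex of $(W_1\cup\cdots\cup W_n)\setminus X_{n-1}$. The strategy is retaining for $X_0$ if $U=V(G)\setminus\bigcup_nX_n$ has $\mathsf{Growth}(U)=\mathsf{Growth}(G)$; finite-step retaining if moreover $W_n=\emptyset$ for all large $n$; containment if $\bigcup_nX_n$ is finite. $G$ has the finite-step (polynomial) retaining property of degree $d$ if there is a polynomial sequence $\{f_n\}$ of degree $d$ such that every finite $X_0$ admits a finite-step retaining $\{f_n\}$-strategy. $G$ has the containment property of degree $d$ if there is $K>0$ such that every finite $X_0$ admits a containment $\{Kn^d\}$-strategy. -}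

module Defs where

open import Level using (0ℓ)
open import Data.Nat using (ℕ; zero; suc; _+_; _*_; _^_; _≤_; _<_)
open import Data.Integer using (+_)
open import Data.Rational as ℚ using (ℚ; 0ℚ)
open import Data.Vec using (Vec; []; _∷_; lookup)
open import Data.Fin using (fromℕ)
open import Data.List using (List; []; length)
open import Data.List.Membership.Propositional using (_∈_)
open import Data.List.Relation.Unary.Unique.Propositional using (Unique)
open import Data.Product using (Σ; ∃; _×_; _,_)
open import Data.Sum using (_⊎_)
open import Relation.Nullary using (¬_)
open import Relation.Binary.PropositionalEquality using (_≡_; _≢_)

record Graph : Set₁ where
  field
    V      : Set
    E      : V → V → Set
    E-sym  : ∀ {x y} → E x y → E y x
    E-irr  : ∀ {x} → ¬ E x x

module _ (G : Graph) where
  open Graph G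

  -- walks of length at most n from x to z all of whose vertices lie in Y
  data WalkIn (Y : V → Set) : V → V → ℕ → Set where
    here : ∀ {x n} → Y x → WalkIn Y x x n
    step : ∀ {x y z n} → Y x → E x y → WalkIn Y y z n → WalkIn Y x z (suc n)

  Everything : V → Set
  Everything _ = Data.Unit.⊤
    where import Data.Unit

  LocallyFinite : Set
  LocallyFinite = ∀ v → Σ (List V) λ ns → ∀ w → E v w → w ∈ ns

  Connected : Set
  Connected = ∀ x y → Σ ℕ λ n → WalkIn Everything x y n

  -- A ray is a one-way infinite path; two rays are equivalent
  -- (same end) if for every finite vertex set S they are joined by a
  -- path avoiding S.  "At least two ends" = two inequivalent rays.

  record Ray : Set where
    field
      r     : ℕ → V
      r-inj : ∀ i j → r i ≡ r j → i ≡ j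
      r-adj : ∀ i → E (r i) (r (suc i))

  Avoid : List V → V → Set
  Avoid S v = ¬ (v ∈ S)

  SameEnd : Ray → Ray → Set
  SameEnd ρ σ = ∀ (S : List V) → Σ ℕ λ i → Σ ℕ λ j → Σ ℕ λ n →
    WalkIn (Avoid S) (Ray.r ρ i) (Ray.r σ j) n

  AtLeastTwoEnds : Set
  AtLeastTwoEnds = Σ Ray λ ρ → Σ Ray λ σ → ¬ SameEnd ρ σ

  -- Growth.  Ball Y A n y : y ∈ Y and dist_Y(A , y) ≤ n  (path-metric of Y).

  Ball : (V → Set) → List V → ℕ → V → Set
  Ball Y A n y = Σ V λ a → a ∈ A × WalkIn Y a y n

  -- |S| ≤ C * |T| + C, for (finite) vertex sets S, T
  CardLe : (V → Set) → (V → Set) → ℕ → Set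
  CardLe S T C = ∀ (xs : List V) → Unique xs → (∀ x → x ∈ xs → S x) →
    Σ (List V) λ ys → Unique ys × (∀ y → y ∈ ys → T y) ×
      (length xs ≤ C * length ys + C)

  GrowthLe : (V → Set) → List V → (V → Set) → List V → Set
  GrowthLe Y A Z B = Σ ℕ λ C → 0 < C ×
    (∀ n → CardLe (Ball Y A n) (Ball Z B (C * n + C)) C)

  BaseOf : (V → Set) → List V → Set
  BaseOf Y A = 0 < length A × (∀ a → a ∈ A → Y a)

  SameGrowthAsG : (V → Set) → Set
  SameGrowthAsG Y = Σ (List V) λ A → Σ (List V) λ B →
    BaseOf Y A × BaseOf Everything B ×
    GrowthLe Y A Everything B × GrowthLe Everything B Y A

  -- Fire game with reach 1.  W (suc i) is the protected set at step i+1
  -- (W zero is ignored).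

  Protected : (ℕ → List V) → ℕ → V → Set
  Protected W k v = Σ ℕ λ i → i < k × v ∈ W (suc i)

  Fire : List V → (ℕ → List V) → ℕ → V → Set
  Fire X₀ W zero v = v ∈ X₀
  Fire X₀ W (suc n) v = Σ V λ u → Fire X₀ W n u ×
    (u ≡ v ⊎ (E u v × ¬ (Protected W (suc n) v × ¬ Fire X₀ W n v)))

  IsStrategy : (ℕ → ℕ) → (ℕ → List V) → Set
  IsStrategy f W = ∀ n → 1 ≤ n → length (W n) ≤ f n

  Unburnt : List V → (ℕ → List V) → V → Set
  Unburnt X₀ W v = ∀ n → ¬ Fire X₀ W n v

  FiniteStepRetaining : List V → (ℕ → List V) → Set
  FiniteStepRetaining X₀ W =
    SameGrowthAsG (Unburnt X₀ W) × (Σ ℕ λ N → ∀ n → N ≤ n → W n ≡ [])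

  Containment : List V → (ℕ → List V) → Set
  Containment X₀ W = Σ (List V) λ L → ∀ n v → Fire X₀ W n v → v ∈ L

-- Polynomial sequences of degree d: f n = c₀ + c₁ n + ... + c_d n^d
-- (rational coefficients, c_d ≠ 0) for all n ≥ 1, values positive integers.

evalPoly : ∀ {k} → Vec ℚ k → ℚ → ℚ
evalPoly [] x = 0ℚ
evalPoly (c ∷ cs) x = c ℚ.+ (x ℚ.* evalPoly cs x)

toℚ : ℕ → ℚ
toℚ n = (+ n) ℚ./ 1

PolySeq : ℕ → (ℕ → ℕ) → Set
PolySeq d f = Σ (Vec ℚ (suc d)) λ cs → lookup cs (fromℕ d) ≢ 0ℚ ×
  (∀ n → 1 ≤ n → (1 ≤ f n) × (toℚ (f n) ≡ evalPoly cs (toℚ n)))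

module _ (G : Graph) where
  open Graph G

  FiniteStepRetainingProperty : ℕ → Set
  FiniteStepRetainingProperty d = Σ (ℕ → ℕ) λ f → PolySeq d f ×
    (∀ (X₀ : List V) → Σ (ℕ → List V) λ W →
       IsStrategy G f W × FiniteStepRetaining G X₀ W)

  ContainmentProperty : ℕ → Set
  ContainmentProperty d = Σ ℕ λ K → 0 < K ×
    (∀ (X₀ : List V) → Σ (ℕ → List V) λ W →
       IsStrategy G (λ n → K * n ^ d) W × Containment G X₀ W)

-- If the retaining strategies contain every finite fire, their polynomial budget is O(n^d), so they
-- already witness the containment property.  Otherwise some fire X₀ escapes a finite-step retaining
-- strategy, which protects only a finite set S in total.  The burnt region is then infinite, and the
-- unburnt region, having the growth of G, is infinite too; each is connected within itself to a finite
-- set (X₀, resp. S), so König's lemma yields a ray in each.  Fire crosses every edge whose endpoint lies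
-- outside S, so a path avoiding S that starts at a burnt vertex stays burnt: the two rays lie in
-- different ends.

module Submission where

open import Defs
open import Level using (0ℓ)
open import Axiom.ExcludedMiddle using (ExcludedMiddle)
open import Axiom.DoubleNegationElimination using (em⇒dne)
open import Data.Empty using (⊥-elim)
open import Data.Integer as ℤ using (+_; -[1+_])
import Data.Integer.Properties as ℤ
open import Data.List using (List; []; _∷_; _++_; length)
open import Data.List.Membership.Propositional using (_∈_; _∉_)
open import Data.List.Membership.Propositional.Properties using (∈-++⁺ˡ; ∈-++⁺ʳ)
open import Data.List.Properties using (length-removeAt′)
open import Data.List.Relation.Binary.Subset.Propositional using (_⊆_)
import Data.List.Relation.Unary.All as All
import Data.List.Relation.Unary.All.Properties as All
open import Data.List.Relation.Unary.AllPairs using ([]; _∷_)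
open import Data.List.Relation.Unary.Any using (here; there; index; _─_)
open import Data.List.Relation.Unary.Unique.Propositional using (Unique)
open import Data.Nat as ℕ using (ℕ; zero; suc; _+_; _*_; _^_; _≤_; _<_; z≤n; s≤s; NonZero)
import Data.Nat.Properties as ℕ
open import Algebra.Properties.CommutativeSemigroup ℕ.*-commutativeSemigroup using (x∙yz≈y∙xz)
open import Data.Nat.Coprimality as Coprimality using ()
open import Data.Product using (Σ; _×_; _,_; proj₁; proj₂)
open import Data.Rational as ℚ using (ℚ; 0ℚ; mkℚ; ↥_)
import Data.Rational.Properties as ℚ
open import Data.Sum using (_⊎_; inj₁; inj₂)
open import Data.Vec using (Vec; []; _∷_)
open import Relation.Binary using (tri<; tri≈; tri>)
open import Relation.Binary.PropositionalEquality
open import Relation.Nullary using (¬_; yes; no)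

-- the normal form of toℚ n, on which ℚ arithmetic computes
fromℕ : ℕ → ℚ
fromℕ n = mkℚ (+ n) 0 (Coprimality.sym (Coprimality.1-coprimeTo n))

toℚ≡fromℕ : ∀ n → toℚ n ≡ fromℕ n
toℚ≡fromℕ n = ℚ.normalize-coprime (Coprimality.sym (Coprimality.1-coprimeTo n))

fromℕ-+ : ∀ m n → fromℕ m ℚ.+ fromℕ n ≡ fromℕ (m + n)
fromℕ-+ m n = trans (cong₂ (λ a b → (a ℤ.+ b) ℚ./ 1) (ℤ.*-identityʳ (+ m)) (ℤ.*-identityʳ (+ n)))
                    (toℚ≡fromℕ (m + n))

fromℕ-* : ∀ m n → fromℕ m ℚ.* fromℕ n ≡ fromℕ (m * n)
fromℕ-* m n = trans (cong (ℚ._/ 1) (sym (ℤ.pos-* m n))) (toℚ≡fromℕ (m * n))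

fromℕ-mono-≤ : ∀ {m n} → m ≤ n → fromℕ m ℚ.≤ fromℕ n
fromℕ-mono-≤ {m} {n} m≤n = ℚ.*≤* (subst₂ ℤ._≤_ (sym (ℤ.*-identityʳ (+ m))) (sym (ℤ.*-identityʳ (+ n))) (ℤ.+≤+ m≤n))

fromℕ-cancel-≤ : ∀ {m n} → fromℕ m ℚ.≤ fromℕ n → m ≤ n
fromℕ-cancel-≤ {m} {n} le = ℤ.drop‿+≤+ (subst₂ ℤ._≤_ (ℤ.*-identityʳ (+ m)) (ℤ.*-identityʳ (+ n)) (ℚ.drop-*≤* le))

∣↥_∣ : ℚ → ℕ
∣↥ q ∣ = ℤ.∣ ↥ q ∣

q≤∣↥q∣ : ∀ q → q ℚ.≤ fromℕ ∣↥ q ∣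
q≤∣↥q∣ (mkℚ (+ k) d-1 _) = ℚ.*≤* (subst₂ ℤ._≤_ (sym (ℤ.*-identityʳ (+ k))) (ℤ.pos-* k (suc d-1))
  (ℤ.+≤+ (ℕ.m≤m*n k (suc d-1))))
q≤∣↥q∣ (mkℚ -[1+ k ] d-1 _) = ℚ.*≤* (subst₂ ℤ._≤_ (sym (ℤ.*-identityʳ -[1+ k ])) (ℤ.pos-* (suc k) (suc d-1))
  ℤ.-≤+)

coefficientBound : ∀ {k} → Vec ℚ k → ℕ
coefficientBound []       = 0
coefficientBound (c ∷ cs) = ∣↥ c ∣ + coefficientBound cs

evalPoly-≤ : ∀ {k} (cs : Vec ℚ (suc k)) n .{{_ : NonZero n}} →
             evalPoly cs (fromℕ n) ℚ.≤ fromℕ (coefficientBound cs * n ^ k)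
evalPoly-≤ (c ∷ []) n = begin
  c ℚ.+ fromℕ n ℚ.* 0ℚ  ≡⟨ trans (cong (c ℚ.+_) (ℚ.*-zeroʳ (fromℕ n))) (ℚ.+-identityʳ c) ⟩
  c                     ≤⟨ q≤∣↥q∣ c ⟩
  fromℕ ∣↥ c ∣           ≡⟨ cong fromℕ (sym (trans (ℕ.*-identityʳ _) (ℕ.+-identityʳ _))) ⟩
  fromℕ ((∣↥ c ∣ + 0) * 1) ∎
  where open ℚ.≤-Reasoning
evalPoly-≤ {suc k} (c ∷ cs@(_ ∷ _)) n = begin
  c ℚ.+ fromℕ n ℚ.* evalPoly cs (fromℕ n)
    ≤⟨ ℚ.+-mono-≤ (q≤∣↥q∣ c) (ℚ.*-monoˡ-≤-nonNeg (fromℕ n) (evalPoly-≤ cs n)) ⟩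
  fromℕ ∣↥ c ∣ ℚ.+ fromℕ n ℚ.* fromℕ (B * n ^ k)
    ≡⟨ trans (cong (fromℕ ∣↥ c ∣ ℚ.+_) (fromℕ-* n _)) (fromℕ-+ ∣↥ c ∣ _) ⟩
  fromℕ (∣↥ c ∣ + n * (B * n ^ k))
    ≤⟨ fromℕ-mono-≤ (ℕ.+-mono-≤ (ℕ.m≤m*n ∣↥ c ∣ (n ^ suc k) {{ℕ.m^n≢0 n (suc k)}})
                                 (ℕ.≤-reflexive (x∙yz≈y∙xz n B (n ^ k)))) ⟩
  fromℕ (∣↥ c ∣ * n ^ suc k + B * n ^ suc k)
    ≡⟨ cong fromℕ (sym (ℕ.*-distribʳ-+ (n ^ suc k) ∣↥ c ∣ B)) ⟩
  fromℕ ((∣↥ c ∣ + B) * n ^ suc k) ∎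
  where
  open ℚ.≤-Reasoning
  B = coefficientBound cs

polySeq-≤-Kn^d : ∀ {d f} → PolySeq d f → Σ ℕ λ K → 0 < K × (∀ n → 1 ≤ n → f n ≤ K * n ^ d)
polySeq-≤-Kn^d {d} {f} (cs , _ , agrees) = suc B , s≤s z≤n , λ n 1≤n →
  ℕ.≤-trans (fromℕ-cancel-≤ (f≤ n 1≤n)) (ℕ.*-monoˡ-≤ (n ^ d) (ℕ.n≤1+n B))
  where
  B = coefficientBound cs
  f≤ : ∀ n → 1 ≤ n → fromℕ (f n) ℚ.≤ fromℕ (B * n ^ d)
  f≤ n 1≤n = subst (ℚ._≤ fromℕ (B * n ^ d))
    (trans (cong (evalPoly cs) (sym (toℚ≡fromℕ n))) (trans (sym (proj₂ (agrees n 1≤n))) (toℚ≡fromℕ (f n))))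
    (evalPoly-≤ cs n {{ℕ.>-nonZero 1≤n}})

module Walk (G : Graph) where
  open Graph G

  private variable
    Y Y′ : V → Set
    x y u v : V
    m n : ℕ

  start∈ : WalkIn G Y x y n → Y x
  start∈ (here p)     = p
  start∈ (step p _ _) = p

  end∈ : WalkIn G Y x y n → Y y
  end∈ (here p)     = p
  end∈ (step _ _ w) = end∈ w

  map : (∀ {v} → Y v → Y′ v) → WalkIn G Y x y n → WalkIn G Y′ x y n
  map f (here p)     = here (f p)
  map f (step p e w) = step (f p) e (map f w)

  snoc : WalkIn G Y x u n → E u v → Y v → WalkIn G Y x v (suc n)
  snoc (here p)      e q = step p e (here q)
  snoc (step p e′ w) e q = step p e′ (snoc w e q)

  reverse : WalkIn G Y x y n → WalkIn G Y y x n
  reverse (here p)     = here p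
  reverse (step p e w) = snoc (reverse w) (E-sym e) p

  weaken : n ≤ m → WalkIn G Y x y n → WalkIn G Y x y m
  weaken _         (here p)     = here p
  weaken (s≤s n≤m) (step p e w) = step p e (weaken n≤m w)

  Reach : (V → Set) → V → V → Set
  Reach Y x y = Σ ℕ λ n → WalkIn G Y x y n

  ReachableFrom : (V → Set) → List V → V → Set
  ReachableFrom Y R y = Σ V λ r → r ∈ R × Reach Y r y

Covered : {A : Set} → (A → Set) → Set
Covered {A} P = Σ (List A) λ L → ∀ y → P y → y ∈ L

Unbounded : {A : Set} → (A → Set) → Set
Unbounded {A} P = ∀ L → Σ A λ y → y ∉ L × P y

unbounded-mono : {A : Set} {P Q : A → Set} → (∀ {y} → P y → Q y) → Unbounded P → Unbounded Q
unbounded-mono P⊆Q unbounded L = let y , y∉L , p = unbounded L in y , y∉L , P⊆Q p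

∈-─⁺ : {A : Set} {x y : A} {xs : List A} (p : x ∈ xs) → y ∈ xs → y ≢ x → y ∈ (xs ─ p)
∈-─⁺ (here refl) (here refl) y≢x = ⊥-elim (y≢x refl)
∈-─⁺ (here refl) (there q)   _   = q
∈-─⁺ (there p)   (here refl) _   = here refl
∈-─⁺ (there p)   (there q)   y≢x = there (∈-─⁺ p q y≢x)

unique⊆⇒length≤ : {A : Set} {xs ys : List A} → Unique xs → xs ⊆ ys → length xs ≤ length ys
unique⊆⇒length≤ {xs = []}     _              _  = z≤n
unique⊆⇒length≤ {xs = x ∷ xs} {ys} (x∉xs ∷ u) xs⊆ys =
  subst (suc (length xs) ≤_) (sym (length-removeAt′ ys (index x∈ys)))
    (s≤s (unique⊆⇒length≤ u λ y∈xs → ∈-─⁺ x∈ys (xs⊆ys (there y∈xs)) λ { refl → All.lookup x∉xs y∈xs refl }))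
  where x∈ys = xs⊆ys (here refl)

module Classical (em : ExcludedMiddle 0ℓ) where

  dne : {P : Set} → ¬ ¬ P → P
  dne = em⇒dne em

  ¬covered⇒unbounded : {A : Set} {P : A → Set} → ¬ Covered P → Unbounded P
  ¬covered⇒unbounded ¬cov L = dne λ ¬ub → ¬cov (L , λ y p → dne λ y∉L → ¬ub (y , y∉L , p))

  unbounded⊎covered : {A : Set} (P : A → Set) → Unbounded P ⊎ Covered P
  unbounded⊎covered P with em {Covered P}
  ... | yes cov  = inj₂ cov
  ... | no ¬cov  = inj₁ (¬covered⇒unbounded ¬cov)

  unbounded-fibre⊎covered : {A B : Set} (P : A → B → Set) (xs : List A) →
    (Σ A λ x → x ∈ xs × Unbounded (P x)) ⊎ Covered (λ y → Σ A λ x → x ∈ xs × P x y)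
  unbounded-fibre⊎covered P []       = inj₂ ([] , λ { _ (_ , () , _) })
  unbounded-fibre⊎covered P (x ∷ xs) with unbounded⊎covered (P x) | unbounded-fibre⊎covered P xs
  ... | inj₁ ub        | _                       = inj₁ (x , here refl , ub)
  ... | inj₂ _         | inj₁ (x′ , x′∈ , ub)    = inj₁ (x′ , there x′∈ , ub)
  ... | inj₂ (L , cov) | inj₂ (L′ , cov′)        = inj₂ (L ++ L′ , λ
        { y (_ , here refl , p) → ∈-++⁺ˡ (cov y p)
        ; y (x′ , there x′∈ , p) → ∈-++⁺ʳ L (cov′ y (x′ , x′∈ , p)) })

module Kőnig (em : ExcludedMiddle 0ℓ) (G : Graph) (locallyFinite : LocallyFinite G) where
  open Graph G
  open Walk G
  open Classical em

  last-exit : ∀ {Y : V → Set} {x y n} v → WalkIn G Y x y n → y ≢ v →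
              WalkIn G (λ z → Y z × z ≢ v) x y n ⊎ (Σ V λ w → E v w × Reach (λ z → Y z × z ≢ v) w y)
  last-exit v (here p) y≢v = inj₁ (here (p , y≢v))
  last-exit {x = x} v (step {y = x′} p e w) y≢v with last-exit v w y≢v
  ... | inj₂ exit = inj₂ exit
  ... | inj₁ w′ with em {x ≡ v}
  ...   | yes refl = inj₂ (x′ , e , _ , w′)
  ...   | no x≢v   = inj₁ (step (p , x≢v) e w′)

  module _ (P : V → Set) where

    private
      Outside : List V → V → Set
      Outside T y = P y × y ∉ T

      Promising : List V → V → Set
      Promising T v = Unbounded (Reach (Outside T) v)

      -- A far vertex is reached from v via the neighbour at which the walk last leaves v, and v has
      -- only finitely many neighbours, so one of them must still reach unboundedly many vertices.
      promising-advance : ∀ T v → Promising T v → Σ V λ w → E v w × Promising (v ∷ T) w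
      promising-advance T v promising
        with unbounded-fibre⊎covered (λ w y → E v w × Reach (Outside (v ∷ T)) w y) (proj₁ (locallyFinite v))
      ... | inj₁ (w , _ , ub) = w , proj₁ (proj₂ (proj₂ (ub []))) , λ L →
            let y , y∉L , _ , r = ub L in y , y∉L , r
      ... | inj₂ (L , cov) with promising (v ∷ L)
      ...   | y , y∉v∷L , _ , walk with last-exit v walk (λ y≡v → y∉v∷L (here y≡v))
      ...     | inj₁ walk′ = ⊥-elim (proj₂ (start∈ walk′) refl)
      ...     | inj₂ (w , e , m , walk′) = ⊥-elim (y∉v∷L (there (cov y
                  (w , proj₂ (locallyFinite v) w e , e , m , map outside walk′))))
        where
        outside : ∀ {z} → Outside T z × z ≢ v → Outside (v ∷ T) z
        outside ((pz , z∉T) , z≢v) = pz , λ { (here z≡v) → z≢v z≡v ; (there z∈T) → z∉T z∈T }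

      record State : Set where
        field
          visited   : List V
          position  : V
          promising : Promising visited position
      open State

      advance : State → State
      advance s = record
        { visited   = position s ∷ visited s
        ; position  = proj₁ (promising-advance _ _ (promising s))
        ; promising = proj₂ (proj₂ (promising-advance _ _ (promising s))) }

      module Run (s₀ : State) where
        state : ℕ → State
        state zero    = s₀
        state (suc i) = advance (state i)

        r : ℕ → V
        r i = position (state i)

        r-adj : ∀ i → E (r i) (r (suc i))
        r-adj i = proj₁ (proj₂ (promising-advance _ _ (promising (state i))))

        r-outside : ∀ i → Outside (visited (state i)) (r i)
        r-outside i with promising (state i) []
        ... | _ , _ , _ , walk = start∈ walk

        r-visited : ∀ {i j} → i < j → r i ∈ visited (state j)
        r-visited {i} {suc j} (s≤s i≤j) with ℕ.m≤n⇒m<n∨m≡n i≤j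
        ... | inj₁ i<j  = there (r-visited i<j)
        ... | inj₂ refl = here refl

        r-distinct : ∀ {i j} → i < j → r i ≢ r j
        r-distinct {i} {j} i<j ri≡rj = proj₂ (r-outside j) (subst (_∈ visited (state j)) ri≡rj (r-visited i<j))

        r-inj : ∀ i j → r i ≡ r j → i ≡ j
        r-inj i j ri≡rj with ℕ.<-cmp i j
        ... | tri< i<j _ _ = ⊥-elim (r-distinct i<j ri≡rj)
        ... | tri≈ _ i≡j _ = i≡j
        ... | tri> _ _ j<i = ⊥-elim (r-distinct j<i (sym ri≡rj))

    ray-in : (R : List V) → Unbounded (ReachableFrom P R) → Σ (Ray G) λ ρ → ∀ i → P (Ray.r ρ i)
    ray-in R unbounded with unbounded-fibre⊎covered (Reach P) R
    ... | inj₂ (L , cov) = ⊥-elim (let y , y∉L , reach = unbounded L in y∉L (cov y reach))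
    ... | inj₁ (r₀ , _ , ub) =
      record { r = r ; r-inj = r-inj ; r-adj = r-adj } , λ i → proj₁ (r-outside i)
      where
      s₀ : State
      s₀ = record { visited = [] ; position = r₀ ; promising = λ L →
        let y , y∉L , n , walk = ub L in y , y∉L , n , map (λ p → p , λ ()) walk }
      open Run s₀

module Growth (G : Graph) (connected : Connected G) where
  open Graph G
  open Walk G

  distinct-within-radius : Unbounded (Everything G) → ∀ b m →
    Σ ℕ λ n → Σ (List V) λ xs → Unique xs × length xs ≡ m × (∀ x → x ∈ xs → WalkIn G (Everything G) b x n)
  distinct-within-radius unbounded b zero = 0 , [] , [] , refl , λ _ ()
  distinct-within-radius unbounded b (suc m) with distinct-within-radius unbounded b m
  ... | n , xs , unique , refl , near with unbounded xs
  ...   | y , y∉xs , _ with connected b y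
  ...     | k , b⇝y = n + k , y ∷ xs , All.¬Any⇒All¬ xs y∉xs ∷ unique , refl , λ
            { _ (here refl) → weaken (ℕ.m≤n+m k n) b⇝y
            ; x (there x∈xs) → weaken (ℕ.m≤m+n n k) (near x x∈xs) }

  module _ (em : ExcludedMiddle 0ℓ) where
    open Classical em

    sameGrowth⇒unbounded : ∀ {Y} → Unbounded (Everything G) → SameGrowthAsG G Y → Unbounded Y
    sameGrowth⇒unbounded unbounded (_ , b ∷ _ , _ , _ , _ , C , _ , G⪯Y) = ¬covered⇒unbounded λ (L , cov) →
      let n , xs , unique , |xs|≡ , near = distinct-within-radius unbounded b (suc (C * length L + C))
          ys , uniqueᵧ , ys∈Ball , |xs|≤ = G⪯Y n xs unique λ x x∈xs → b , here refl , near x x∈xs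
          |ys|≤|L| = unique⊆⇒length≤ uniqueᵧ λ {y} y∈ys → cov y (end∈ (proj₂ (proj₂ (ys∈Ball y y∈ys))))
      in ℕ.1+n≰n (subst (_≤ C * length L + C) |xs|≡ (ℕ.≤-trans |xs|≤ (ℕ.+-monoˡ-≤ C (ℕ.*-monoʳ-≤ C |ys|≤|L|))))

module FireGame (G : Graph) (W : ℕ → List (Graph.V G)) (N : ℕ) (W-quiet : ∀ n → N ≤ n → W n ≡ []) where
  open Graph G
  open Walk G

  protectedBefore : ℕ → List V
  protectedBefore zero    = []
  protectedBefore (suc k) = W (suc k) ++ protectedBefore k

  ∈-protectedBefore : ∀ {i k v} → i < k → v ∈ W (suc i) → v ∈ protectedBefore k
  ∈-protectedBefore {i} {suc k} (s≤s i≤k) v∈W with ℕ.m≤n⇒m<n∨m≡n i≤k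
  ... | inj₁ i<k  = ∈-++⁺ʳ (W (suc k)) (∈-protectedBefore i<k v∈W)
  ... | inj₂ refl = ∈-++⁺ˡ v∈W

  everProtected : List V
  everProtected = protectedBefore N

  protected⇒everProtected : ∀ {k v} → Protected G W k v → v ∈ everProtected
  protected⇒everProtected {v = v} (i , _ , v∈W) with i ℕ.<? N
  ... | yes i<N = ∈-protectedBefore i<N v∈W
  ... | no  i≮N with subst (v ∈_) (W-quiet (suc i) (ℕ.m≤n⇒m≤1+n (ℕ.≮⇒≥ i≮N))) v∈W
  ...   | ()

  module _ (X₀ : List V) where

    Burnt : V → Set
    Burnt v = Σ ℕ λ n → Fire G X₀ W n v

    burnt-spreads : ∀ {u v} → Burnt u → E u v → v ∉ everProtected → Burnt v
    burnt-spreads {u} (n , u-burns) e v∉S =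
      suc n , u , u-burns , inj₂ (e , λ (protected , _) → v∉S (protected⇒everProtected protected))

    burnt-along-unprotected : ∀ {x y n} → WalkIn G (Avoid G everProtected) x y n → Burnt x → Burnt y
    burnt-along-unprotected (here _)     x-burnt = x-burnt
    burnt-along-unprotected (step _ e w) x-burnt = burnt-along-unprotected w (burnt-spreads x-burnt e (start∈ w))

    burnt-reachable : ∀ {y} → Burnt y → ReachableFrom Burnt X₀ y
    burnt-reachable (zero , y∈X₀) = _ , y∈X₀ , 0 , here (0 , y∈X₀)
    burnt-reachable (suc n , u , u-burns , inj₁ refl) = burnt-reachable (n , u-burns)
    burnt-reachable (suc n , u , u-burns , inj₂ (e , spread)) =
      let r , r∈X₀ , m , walk = burnt-reachable (n , u-burns)
      in r , r∈X₀ , suc m , snoc walk e (suc n , u , u-burns , inj₂ (e , spread))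

    module _ (em : ExcludedMiddle 0ℓ) where

      -- the last unburnt vertex before the walk enters the fire is protected, or the fire would spread to it
      unburnt-reaches-protected : ∀ {u b k} → WalkIn G (Everything G) u b k → Unburnt G X₀ W u → Burnt b →
                                  Σ V λ s → s ∈ everProtected × Reach (Unburnt G X₀ W) u s
      unburnt-reaches-protected (here _) u-unburnt (n , burns) = ⊥-elim (u-unburnt n burns)
      unburnt-reaches-protected {u} (step {y = x} _ e w) u-unburnt b-burnt with em {Burnt x}
      ... | no x-unburnt =
            let s , s∈S , m , walk = unburnt-reaches-protected w (λ n burns → x-unburnt (n , burns)) b-burnt
            in s , s∈S , suc m , step u-unburnt e walk
      ... | yes x-burnt with em {u ∈ everProtected}
      ...   | yes u∈S = u , u∈S , 0 , here u-unburnt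
      ...   | no  u∉S = ⊥-elim (let n , burns = burnt-spreads x-burnt (E-sym e) u∉S in u-unburnt n burns)

      two-ends : LocallyFinite G → Connected G → ¬ Containment G X₀ W →
                 SameGrowthAsG G (Unburnt G X₀ W) → AtLeastTwoEnds G
      two-ends locallyFinite connected escapes sameGrowth =
        proj₁ burnt-ray , proj₁ unburnt-ray , λ sameEnd →
          let i , j , _ , walk = sameEnd everProtected
              n , burns = burnt-along-unprotected walk (proj₂ burnt-ray i)
          in proj₂ unburnt-ray j n burns
        where
        open Classical em
        open Kőnig em G locallyFinite

        burnt-unbounded : Unbounded Burnt
        burnt-unbounded = ¬covered⇒unbounded λ (L , cov) → escapes (L , λ n v burns → cov v (n , burns))

        unburnt-reachable : ∀ {u} → Unburnt G X₀ W u → ReachableFrom (Unburnt G X₀ W) everProtected u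
        unburnt-reachable {u} u-unburnt =
          let b , _ , b-burnt = burnt-unbounded []
              _ , u⇝b = connected u b
              s , s∈S , m , u⇝s = unburnt-reaches-protected u⇝b u-unburnt b-burnt
          in s , s∈S , m , reverse u⇝s

        unburnt-unbounded : Unbounded (Unburnt G X₀ W)
        unburnt-unbounded = Growth.sameGrowth⇒unbounded G connected em (unbounded-mono _ burnt-unbounded) sameGrowth

        burnt-ray : Σ (Ray G) λ ρ → ∀ i → Burnt (Ray.r ρ i)
        burnt-ray = ray-in Burnt X₀ (unbounded-mono burnt-reachable burnt-unbounded)

        unburnt-ray : Σ (Ray G) λ ρ → ∀ i → Unburnt G X₀ W (Ray.r ρ i)
        unburnt-ray = ray-in (Unburnt G X₀ W) everProtected (unbounded-mono unburnt-reachable unburnt-unbounded)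

proposition5p5 : ExcludedMiddle 0ℓ → (G : Graph) → LocallyFinite G → Connected G →
    (d : ℕ) → FiniteStepRetainingProperty G d →
    ContainmentProperty G d ⊎ AtLeastTwoEnds G
proposition5p5 em G locallyFinite connected d (f , polynomial , strategy)
  with em {Σ (List (Graph.V G)) λ X₀ → ¬ Containment G X₀ (proj₁ (strategy X₀))}
... | yes (X₀ , escapes) =
  let W , _ , unburnt-sameGrowth , N , W-quiet = strategy X₀
  in inj₂ (FireGame.two-ends G W N W-quiet X₀ em locallyFinite connected escapes unburnt-sameGrowth)
... | no never-escapes =
  let K , K>0 , f≤Kn^d = polySeq-≤-Kn^d polynomial
  in inj₁ (K , K>0 , λ X₀ →
    let W , W≤f , _ = strategy X₀
    in W , (λ n n≥1 → ℕ.≤-trans (W≤f n n≥1) (f≤Kn^d n n≥1)) ,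
       Classical.dne em λ escapes → never-escapes (X₀ , escapes))
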